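{- Let $\mathcal{J}$ be an instance whose data points $X$ (each in exactly one of groups $X_1,\dots,X_\ell$) are located at $k$ locations $c_1,\dots,c_k$; let $C_i$ be the set of points located at $c_i$. Assume every $C_i$ is $3$-approximately fair, i.e. $\bigl||C_i\cap X_j| - \frac{f_j}{f}|C_i|\bigr|\le 3$ for all $i\in[k]$, $j\in[\ell]$. For each $i$, let $F_i\subseteq C_i$ be a maximal exactly fair subset of $C_i$ and $P_i = C_i\setminus F_i$. Then $|P_i| < 4f$ for every $i\in[k]$.
   Context: A set $S\subseteq X$ is exactly fair if $|S\cap X_j| = \frac{|X_j|}{|X|}|S|$ for every $j\in[\ell]$. The fairlet size $f$ is the smallest positive integer such that $f_j := f\frac{|X_j|}{|X|}$ is an integer for every $j$; a fairlet is a set with exactly $f_j$ points of group $j$ for each $j$, and every exactly fair set is a disjoint union of fairlets. -}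

module Defs where

open import Data.Nat using (ℕ; _*_; _≤_; _<_; _/_; NonZero; ∣_-_∣)
open import Data.Nat.Divisibility using (_∣_)
open import Data.Fin using (Fin; _≟_)
open import Data.Fin.Subset using (Subset; _∩_; _⊆_; ∣_∣)
open import Data.Vec using (tabulate)
open import Data.Product using (_×_)
open import Relation.Nullary.Decidable using (⌊_⌋)
open import Relation.Binary.PropositionalEquality using (_≡_)

-- The data set X is Fin n (so |X| = n); each point x lies in exactly one
-- group  grp x : Fin ℓ  and at exactly one location  loc x : Fin k.
module Instance {n ℓ k : ℕ} (grp : Fin n → Fin ℓ) (loc : Fin n → Fin k) where

  X : Fin ℓ → Subset n
  X j = tabulate (λ x → ⌊ grp x ≟ j ⌋)

  C : Fin k → Subset n
  C i = tabulate (λ x → ⌊ loc x ≟ i ⌋)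

  -- exactly fair:  |S ∩ X_j| = (|X_j| / |X|) |S|   (cleared of denominators)
  ExactlyFair : Subset n → Set
  ExactlyFair S = ∀ j → ∣ S ∩ X j ∣ * n ≡ ∣ X j ∣ * ∣ S ∣

  IsFairletSize : ℕ → Set
  IsFairletSize f =
    (0 < f) × (∀ j → n ∣ f * ∣ X j ∣)
    × (∀ f' → 0 < f' → (∀ j → n ∣ f' * ∣ X j ∣) → f ≤ f')

  fj : .{{NonZero n}} → ℕ → Fin ℓ → ℕ
  fj f j = (f * ∣ X j ∣) / n

  -- 3-approximately fair:  | |S ∩ X_j| - (f_j / f) |S| | ≤ 3 for all j,
  -- multiplied through by f > 0
  ApproxFair3 : .{{NonZero n}} → ℕ → Subset n → Set
  ApproxFair3 f S = ∀ j → ∣ ∣ S ∩ X j ∣ * f - fj f j * ∣ S ∣ ∣ ≤ 3 * f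

  MaximalFairSubset : Subset n → Subset n → Set
  MaximalFairSubset S F =
    F ⊆ S × ExactlyFair F
    × (∀ T → F ⊆ T → T ⊆ S → ExactlyFair T → T ⊆ F)

-- If |C ─ F| ≥ 4f, then for every group j approximate fairness of C and exact
-- fairness of F give  f_j |C ─ F| ≤ (|(C ─ F) ∩ X_j| + 3) f,  hence
-- 4 f_j ≤ |(C ─ F) ∩ X_j| + 3  and so  f_j ≤ |(C ─ F) ∩ X_j|.  Then C ─ F contains
-- a fairlet, and adding it to F gives a strictly larger exactly fair subset of
-- C, contradicting maximality.
module Submission where

open import Data.Fin as Fin using (Fin; zero; suc; _≟_)
open import Data.Fin.Subset
  using (Subset; _∩_; _∪_; _─_; _⊆_; _∈_; _∉_; Empty; ∣_∣; ⊤; inside; outside)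
open import Data.Fin.Subset.Properties
  using ( drop-∷-Empty; drop-∷-⊆; s⊆s; out⊆; ⊆-refl; p⊆q⇒∣p∣≤∣q∣; ∣⊤∣≡n
        ; x∈p∩q⁻; x∈p∪q⁻; p⊆p∪q; p─q⊆p; ∩-identityˡ; ∩-identityʳ )
open import Data.Nat
  using (ℕ; NonZero; >-nonZero; zero; suc; pred; _+_; _*_; ∣_-_∣; _≤_; _<_; z≤n; s≤s; s≤s⁻¹)
open import Data.Nat.Divisibility using (_∣_)
open import Data.Nat.DivMod using (m/n*n≡m)
open import Data.Nat.Properties
  using ( +-comm; +-suc; *-comm; *-assoc; *-suc; *-distribˡ-+; *-distribʳ-+
        ; +-*-semiring; *-commutativeSemigroup
        ; +-cancelˡ-≤; *-cancelʳ-≡; *-cancelʳ-≤; *-cancelˡ-<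
        ; +-monoʳ-<; +-monoˡ-≤; *-monoʳ-≤; pred-mono-≤; n<1+n; m≤n*m; m<m+n
        ; n≤0⇒n≡0; ≰⇒>; <⇒≱; module ≤-Reasoning )
open import Data.Nat.Tactic.RingSolver using (solve-∀)
open import Data.Product using (∃-syntax; _×_; _,_)
open import Data.Sum using ([_,_]′)
open import Data.Vec using ([]; _∷_; tabulate; here; there)
open import Data.Vec.Functional using (updateAt)
open import Data.Vec.Functional.Properties using (updateAt-updates; updateAt-minimal)
open import Function using (_∘_)
open import Relation.Binary.PropositionalEquality
open import Relation.Nullary using (yes; no; contradiction)
open import Relation.Nullary.Decidable using (⌊_⌋)

open import Algebra.Properties.Semiring.Sum +-*-semiring
  using (sum-syntax; sum-cong-≗; sum-replicate-zero; *-distribˡ-sum; *-distribʳ-sum)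
open import Algebra.Properties.CommutativeSemigroup *-commutativeSemigroup
  using (xy∙z≈xz∙y; x∙yz≈y∙xz)

open import Defs

private variable
  n ℓ : ℕ

x∈p─q⇒x∉q : ∀ {x : Fin n} (p q : Subset n) → x ∈ p ─ q → x ∉ q
x∈p─q⇒x∉q (inside ∷ p) (outside ∷ q) here           ()
x∈p─q⇒x∉q (_      ∷ p) (_       ∷ q) (there x∈p─q) (there x∈q) = x∈p─q⇒x∉q p q x∈p─q x∈q

p⊆q─r⇒Empty[r∩p] : ∀ {p q r : Subset n} → p ⊆ q ─ r → Empty (r ∩ p)
p⊆q─r⇒Empty[r∩p] {p = p} {q} {r} p⊆q─r (x , x∈r∩p) =
  let x∈r , x∈p = x∈p∩q⁻ r p x∈r∩p in x∈p─q⇒x∉q q r (p⊆q─r x∈p) x∈r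

p⊆q⇒p∪[q─p]≡q : ∀ {p q : Subset n} → p ⊆ q → p ∪ (q ─ p) ≡ q
p⊆q⇒p∪[q─p]≡q {p = []}          {[]}          _   = refl
p⊆q⇒p∪[q─p]≡q {p = outside ∷ p} {outside ∷ q} p⊆q = cong (outside ∷_) (p⊆q⇒p∪[q─p]≡q (drop-∷-⊆ p⊆q))
p⊆q⇒p∪[q─p]≡q {p = outside ∷ p} {inside  ∷ q} p⊆q = cong (inside ∷_) (p⊆q⇒p∪[q─p]≡q (drop-∷-⊆ p⊆q))
p⊆q⇒p∪[q─p]≡q {p = inside  ∷ p} {outside ∷ q} p⊆q = contradiction (p⊆q here) λ ()
p⊆q⇒p∪[q─p]≡q {p = inside  ∷ p} {inside  ∷ q} p⊆q = cong (inside ∷_) (p⊆q⇒p∪[q─p]≡q (drop-∷-⊆ p⊆q))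

∣[p∪q]∩r∣≡∣p∩r∣+∣q∩r∣ : ∀ (p q r : Subset n) → Empty (p ∩ q) →
                        ∣ (p ∪ q) ∩ r ∣ ≡ ∣ p ∩ r ∣ + ∣ q ∩ r ∣
∣[p∪q]∩r∣≡∣p∩r∣+∣q∩r∣ []            []            []            _ = refl
∣[p∪q]∩r∣≡∣p∩r∣+∣q∩r∣ (inside  ∷ p) (inside  ∷ q) (_       ∷ r) e = contradiction (zero , here) e
∣[p∪q]∩r∣≡∣p∩r∣+∣q∩r∣ (inside  ∷ p) (outside ∷ q) (inside  ∷ r) e =
  cong suc (∣[p∪q]∩r∣≡∣p∩r∣+∣q∩r∣ p q r (drop-∷-Empty e))
∣[p∪q]∩r∣≡∣p∩r∣+∣q∩r∣ (outside ∷ p) (inside  ∷ q) (inside  ∷ r) e =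
  trans (cong suc (∣[p∪q]∩r∣≡∣p∩r∣+∣q∩r∣ p q r (drop-∷-Empty e))) (sym (+-suc _ _))
∣[p∪q]∩r∣≡∣p∩r∣+∣q∩r∣ (inside  ∷ p) (outside ∷ q) (outside ∷ r) e = ∣[p∪q]∩r∣≡∣p∩r∣+∣q∩r∣ p q r (drop-∷-Empty e)
∣[p∪q]∩r∣≡∣p∩r∣+∣q∩r∣ (outside ∷ p) (inside  ∷ q) (outside ∷ r) e = ∣[p∪q]∩r∣≡∣p∩r∣+∣q∩r∣ p q r (drop-∷-Empty e)
∣[p∪q]∩r∣≡∣p∩r∣+∣q∩r∣ (outside ∷ p) (outside ∷ q) (_       ∷ r) e = ∣[p∪q]∩r∣≡∣p∩r∣+∣q∩r∣ p q r (drop-∷-Empty e)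

∣p∪q∣≡∣p∣+∣q∣ : ∀ {p q : Subset n} → Empty (p ∩ q) → ∣ p ∪ q ∣ ≡ ∣ p ∣ + ∣ q ∣
∣p∪q∣≡∣p∣+∣q∣ {p = p} {q} disjoint = begin
  ∣ p ∪ q ∣             ≡⟨ cong ∣_∣ (∩-identityʳ (p ∪ q)) ⟨
  ∣ (p ∪ q) ∩ ⊤ ∣       ≡⟨ ∣[p∪q]∩r∣≡∣p∩r∣+∣q∩r∣ p q ⊤ disjoint ⟩
  ∣ p ∩ ⊤ ∣ + ∣ q ∩ ⊤ ∣ ≡⟨ cong₂ _+_ (cong ∣_∣ (∩-identityʳ p)) (cong ∣_∣ (∩-identityʳ q)) ⟩
  ∣ p ∣ + ∣ q ∣         ∎
  where open ≡-Reasoning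

p⊆q⇒∣q∩r∣≡∣p∩r∣+∣[q─p]∩r∣ : ∀ {p q : Subset n} (r : Subset n) → p ⊆ q →
                            ∣ q ∩ r ∣ ≡ ∣ p ∩ r ∣ + ∣ (q ─ p) ∩ r ∣
p⊆q⇒∣q∩r∣≡∣p∩r∣+∣[q─p]∩r∣ {p = p} {q} r p⊆q = begin
  ∣ q ∩ r ∣                   ≡⟨ cong (λ s → ∣ s ∩ r ∣) (p⊆q⇒p∪[q─p]≡q p⊆q) ⟨
  ∣ (p ∪ (q ─ p)) ∩ r ∣       ≡⟨ ∣[p∪q]∩r∣≡∣p∩r∣+∣q∩r∣ p (q ─ p) r (p⊆q─r⇒Empty[r∩p] ⊆-refl) ⟩
  ∣ p ∩ r ∣ + ∣ (q ─ p) ∩ r ∣ ∎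
  where open ≡-Reasoning

p⊆q⇒∣q∣≡∣p∣+∣q─p∣ : ∀ {p q : Subset n} → p ⊆ q → ∣ q ∣ ≡ ∣ p ∣ + ∣ q ─ p ∣
p⊆q⇒∣q∣≡∣p∣+∣q─p∣ {p = p} {q} p⊆q = begin
  ∣ q ∣                       ≡⟨ cong ∣_∣ (∩-identityʳ q) ⟨
  ∣ q ∩ ⊤ ∣                   ≡⟨ p⊆q⇒∣q∩r∣≡∣p∩r∣+∣[q─p]∩r∣ ⊤ p⊆q ⟩
  ∣ p ∩ ⊤ ∣ + ∣ (q ─ p) ∩ ⊤ ∣ ≡⟨ cong₂ _+_ (cong ∣_∣ (∩-identityʳ p)) (cong ∣_∣ (∩-identityʳ (q ─ p))) ⟩
  ∣ p ∣ + ∣ q ─ p ∣           ∎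
  where open ≡-Reasoning

-- Instance.X grp loc j is definitionally fibre grp j.
fibre : (Fin n → Fin ℓ) → Fin ℓ → Subset n
fibre g j = tabulate (λ x → ⌊ g x ≟ j ⌋)

-- Not definitional: ⌊_⌋ is stuck on the map′ that _≟_ returns for suc/suc.
⌊suc≟suc⌋≡⌊≟⌋ : ∀ (a j : Fin ℓ) → ⌊ Fin.suc a ≟ Fin.suc j ⌋ ≡ ⌊ a ≟ j ⌋
⌊suc≟suc⌋≡⌊≟⌋ a j with a ≟ j
... | yes _ = refl
... | no  _ = refl

∑∣[a≟j]∷r∣≡1+∑∣r∣ : ∀ (a : Fin ℓ) (r : Fin ℓ → Subset n) →
                    ∑[ j < ℓ ] ∣ ⌊ a ≟ j ⌋ ∷ r j ∣ ≡ suc (∑[ j < ℓ ] ∣ r j ∣)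
∑∣[a≟j]∷r∣≡1+∑∣r∣ zero    r = refl
∑∣[a≟j]∷r∣≡1+∑∣r∣ {ℓ = suc ℓ} (suc a) r = begin
  ∣ r zero ∣ + ∑[ j < ℓ ] ∣ ⌊ Fin.suc a ≟ Fin.suc j ⌋ ∷ r (Fin.suc j) ∣
    ≡⟨ cong (∣ r zero ∣ +_) (sum-cong-≗ λ j → cong (λ b → ∣ b ∷ r (Fin.suc j) ∣) (⌊suc≟suc⌋≡⌊≟⌋ a j)) ⟩
  ∣ r zero ∣ + ∑[ j < ℓ ] ∣ ⌊ a ≟ j ⌋ ∷ r (Fin.suc j) ∣
    ≡⟨ cong (∣ r zero ∣ +_) (∑∣[a≟j]∷r∣≡1+∑∣r∣ a (r ∘ Fin.suc)) ⟩
  ∣ r zero ∣ + suc (∑[ j < ℓ ] ∣ r (Fin.suc j) ∣)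
    ≡⟨ +-suc ∣ r zero ∣ _ ⟩
  suc (∑[ j < suc ℓ ] ∣ r j ∣) ∎
  where open ≡-Reasoning

∑∣p∩fibre∣≡∣p∣ : ∀ (g : Fin n → Fin ℓ) (p : Subset n) → ∑[ j < ℓ ] ∣ p ∩ fibre g j ∣ ≡ ∣ p ∣
∑∣p∩fibre∣≡∣p∣ {ℓ = ℓ} g []            = sum-replicate-zero ℓ
∑∣p∩fibre∣≡∣p∣         g (outside ∷ p) = ∑∣p∩fibre∣≡∣p∣ (g ∘ Fin.suc) p
∑∣p∩fibre∣≡∣p∣         g (inside  ∷ p) =
  trans (∑∣[a≟j]∷r∣≡1+∑∣r∣ (g zero) (λ j → p ∩ fibre (g ∘ Fin.suc) j))
        (cong suc (∑∣p∩fibre∣≡∣p∣ (g ∘ Fin.suc) p))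

module _ (q : Fin ℓ → ℕ) (a : Fin ℓ) where

  updateAt-pred-≤ : ∀ {j} {r : Subset n} → q j ≤ ∣ ⌊ a ≟ j ⌋ ∷ r ∣ → updateAt q a pred j ≤ ∣ r ∣
  updateAt-pred-≤ {j = j} q≤ with a ≟ j
  ... | yes refl rewrite updateAt-updates a {pred} q = pred-mono-≤ q≤
  ... | no  a≢j  rewrite updateAt-minimal j a {pred} q (a≢j ∘ sym) = q≤

  updateAt-pred-0 : q a ≡ 0 → ∀ j → updateAt q a pred j ≡ q j
  updateAt-pred-0 qa≡0 j with j ≟ a
  ... | yes refl rewrite updateAt-updates a {pred} q | qa≡0 = refl
  ... | no  j≢a  = updateAt-minimal j a q j≢a

  updateAt-pred-suc : ∀ {m j} {r : Subset n} → q a ≡ suc m →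
                      ∣ r ∣ ≡ updateAt q a pred j → ∣ ⌊ a ≟ j ⌋ ∷ r ∣ ≡ q j
  updateAt-pred-suc {j = j} qa≡1+m ∣r∣≡ with a ≟ j
  ... | yes refl rewrite updateAt-updates a {pred} q | qa≡1+m = cong suc ∣r∣≡
  ... | no  a≢j  rewrite updateAt-minimal j a {pred} q (a≢j ∘ sym) = ∣r∣≡

-- Greedily keep a point of p iff the quota of its fibre is not yet exhausted.
∃⊆-with-fibre-sizes : ∀ (g : Fin n → Fin ℓ) (p : Subset n) (q : Fin ℓ → ℕ) →
                      (∀ j → q j ≤ ∣ p ∩ fibre g j ∣) →
                      ∃[ s ] s ⊆ p × ∀ j → ∣ s ∩ fibre g j ∣ ≡ q j
∃⊆-with-fibre-sizes g []            q q≤ = [] , (λ ()) , λ j → sym (n≤0⇒n≡0 (q≤ j))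
∃⊆-with-fibre-sizes g (outside ∷ p) q q≤ =
  let s , s⊆p , ∣s∩∣≡q = ∃⊆-with-fibre-sizes (g ∘ Fin.suc) p q q≤
  in  outside ∷ s , out⊆ s⊆p , ∣s∩∣≡q
∃⊆-with-fibre-sizes g (inside  ∷ p) q q≤
  with q (g zero) in qa≡
     | ∃⊆-with-fibre-sizes (g ∘ Fin.suc) p (updateAt q (g zero) pred)
         (λ j → updateAt-pred-≤ q (g zero) {r = p ∩ fibre (g ∘ Fin.suc) j} (q≤ j))
... | zero  | s , s⊆p , ∣s∩∣≡q′ =
  outside ∷ s , out⊆ s⊆p , λ j → trans (∣s∩∣≡q′ j) (updateAt-pred-0 q (g zero) qa≡ j)
... | suc _ | s , s⊆p , ∣s∩∣≡q′ =
  inside ∷ s , s⊆s s⊆p , λ j → updateAt-pred-suc q (g zero) {r = s ∩ fibre (g ∘ Fin.suc) j} qa≡ (∣s∩∣≡q′ j)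

∣m-n∣≤o⇒n≤m+o : ∀ m n {o} → ∣ m - n ∣ ≤ o → n ≤ m + o
∣m-n∣≤o⇒n≤m+o zero    n       ∣m-n∣≤o = ∣m-n∣≤o
∣m-n∣≤o⇒n≤m+o (suc m) zero    _       = z≤n
∣m-n∣≤o⇒n≤m+o (suc m) (suc n) ∣m-n∣≤o = s≤s (∣m-n∣≤o⇒n≤m+o m n ∣m-n∣≤o)

4*m≤n+3⇒m≤n : ∀ m n → 4 * m ≤ n + 3 → m ≤ n
4*m≤n+3⇒m≤n m n 4*m≤n+3 = s≤s⁻¹ (*-cancelˡ-< 4 m (suc n) (begin-strict
  4 * m     ≤⟨ 4*m≤n+3 ⟩
  n + 3     <⟨ +-monoʳ-< n (n<1+n 3) ⟩
  n + 4     ≤⟨ +-monoˡ-≤ 4 (m≤n*m n 4) ⟩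
  4 * n + 4 ≡⟨ +-comm (4 * n) 4 ⟩
  4 + 4 * n ≡⟨ *-suc 4 n ⟨
  4 * suc n ∎))
  where open ≤-Reasoning

module Fairlets {n ℓ k : ℕ} .{{_ : NonZero n}} (grp : Fin n → Fin ℓ) (loc : Fin n → Fin k)
  (f : ℕ) (0<f : 0 < f) (n∣f*∣Xj∣ : ∀ j → n ∣ f * ∣ Instance.X grp loc j ∣) where

  open Instance grp loc

  fj*n≡f*∣Xj∣ : ∀ j → fj f j * n ≡ f * ∣ X j ∣
  fj*n≡f*∣Xj∣ j = m/n*n≡m (n∣f*∣Xj∣ j)

  ∑∣Xj∣≡n : ∑[ j < ℓ ] ∣ X j ∣ ≡ n
  ∑∣Xj∣≡n = begin
    ∑[ j < ℓ ] ∣ X j ∣     ≡⟨ sum-cong-≗ (λ j → cong ∣_∣ (∩-identityˡ (X j))) ⟨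
    ∑[ j < ℓ ] ∣ ⊤ ∩ X j ∣ ≡⟨ ∑∣p∩fibre∣≡∣p∣ grp ⊤ ⟩
    ∣ ⊤ {n} ∣              ≡⟨ ∣⊤∣≡n n ⟩
    n                      ∎
    where open ≡-Reasoning

  ∑fj≡f : ∑[ j < ℓ ] fj f j ≡ f
  ∑fj≡f = *-cancelʳ-≡ _ _ n (begin
    (∑[ j < ℓ ] fj f j) * n  ≡⟨ *-distribʳ-sum n (fj f) ⟩
    ∑[ j < ℓ ] (fj f j * n)  ≡⟨ sum-cong-≗ fj*n≡f*∣Xj∣ ⟩
    ∑[ j < ℓ ] (f * ∣ X j ∣) ≡⟨ *-distribˡ-sum f (λ j → ∣ X j ∣) ⟨
    f * (∑[ j < ℓ ] ∣ X j ∣) ≡⟨ cong (f *_) ∑∣Xj∣≡n ⟩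
    f * n                    ∎)
    where open ≡-Reasoning

  IsFairlet : Subset n → Set
  IsFairlet S = ∀ j → ∣ S ∩ X j ∣ ≡ fj f j

  fairlet⇒∣S∣≡f : ∀ {S} → IsFairlet S → ∣ S ∣ ≡ f
  fairlet⇒∣S∣≡f {S} fairlet = begin
    ∣ S ∣                  ≡⟨ ∑∣p∩fibre∣≡∣p∣ grp S ⟨
    ∑[ j < ℓ ] ∣ S ∩ X j ∣ ≡⟨ sum-cong-≗ fairlet ⟩
    ∑[ j < ℓ ] fj f j      ≡⟨ ∑fj≡f ⟩
    f                      ∎
    where open ≡-Reasoning

  fairlet⇒exactlyFair : ∀ {S} → IsFairlet S → ExactlyFair S
  fairlet⇒exactlyFair {S} fairlet j = begin
    ∣ S ∩ X j ∣ * n ≡⟨ cong (_* n) (fairlet j) ⟩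
    fj f j * n      ≡⟨ fj*n≡f*∣Xj∣ j ⟩
    f * ∣ X j ∣     ≡⟨ *-comm f (∣ X j ∣) ⟩
    ∣ X j ∣ * f     ≡⟨ cong (∣ X j ∣ *_) (fairlet⇒∣S∣≡f {S} fairlet) ⟨
    ∣ X j ∣ * ∣ S ∣ ∎
    where open ≡-Reasoning

  exactlyFair⇒∣S∩Xj∣*f≡fj*∣S∣ : ∀ {S} → ExactlyFair S → ∀ j → ∣ S ∩ X j ∣ * f ≡ fj f j * ∣ S ∣
  exactlyFair⇒∣S∩Xj∣*f≡fj*∣S∣ {S} fair j = *-cancelʳ-≡ _ _ n (begin
    ∣ S ∩ X j ∣ * f * n ≡⟨ xy∙z≈xz∙y (∣ S ∩ X j ∣) f n ⟩
    ∣ S ∩ X j ∣ * n * f ≡⟨ cong (_* f) (fair j) ⟩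
    ∣ X j ∣ * ∣ S ∣ * f ≡⟨ xy∙z≈xz∙y (∣ X j ∣) (∣ S ∣) f ⟩
    ∣ X j ∣ * f * ∣ S ∣ ≡⟨ cong (_* ∣ S ∣) (trans (*-comm (∣ X j ∣) f) (sym (fj*n≡f*∣Xj∣ j))) ⟩
    fj f j * n * ∣ S ∣  ≡⟨ xy∙z≈xz∙y (fj f j) n (∣ S ∣) ⟩
    fj f j * ∣ S ∣ * n  ∎)
    where open ≡-Reasoning

  ∪-exactlyFair : ∀ {S T} → Empty (S ∩ T) → ExactlyFair S → ExactlyFair T → ExactlyFair (S ∪ T)
  ∪-exactlyFair {S} {T} disjoint fairS fairT j = begin
    ∣ (S ∪ T) ∩ X j ∣ * n             ≡⟨ cong (_* n) (∣[p∪q]∩r∣≡∣p∩r∣+∣q∩r∣ S T (X j) disjoint) ⟩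
    (∣ S ∩ X j ∣ + ∣ T ∩ X j ∣) * n   ≡⟨ *-distribʳ-+ n (∣ S ∩ X j ∣) (∣ T ∩ X j ∣) ⟩
    ∣ S ∩ X j ∣ * n + ∣ T ∩ X j ∣ * n ≡⟨ cong₂ _+_ (fairS j) (fairT j) ⟩
    ∣ X j ∣ * ∣ S ∣ + ∣ X j ∣ * ∣ T ∣ ≡⟨ *-distribˡ-+ (∣ X j ∣) (∣ S ∣) (∣ T ∣) ⟨
    ∣ X j ∣ * (∣ S ∣ + ∣ T ∣)         ≡⟨ cong (∣ X j ∣ *_) (∣p∪q∣≡∣p∣+∣q∣ disjoint) ⟨
    ∣ X j ∣ * ∣ S ∪ T ∣               ∎
    where open ≡-Reasoning

  module _ {S F : Subset n} (approx : ApproxFair3 f S) (F⊆S : F ⊆ S) (fairF : ExactlyFair F) where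

    fj*∣S─F∣≤[∣[S─F]∩Xj∣+3]*f : ∀ j → fj f j * ∣ S ─ F ∣ ≤ (∣ (S ─ F) ∩ X j ∣ + 3) * f
    fj*∣S─F∣≤[∣[S─F]∩Xj∣+3]*f j = +-cancelˡ-≤ (a * ∣ F ∣) _ _ (begin
      a * ∣ F ∣ + a * ∣ S ─ F ∣ ≡⟨ *-distribˡ-+ a (∣ F ∣) (∣ S ─ F ∣) ⟨
      a * (∣ F ∣ + ∣ S ─ F ∣)   ≡⟨ cong (a *_) (p⊆q⇒∣q∣≡∣p∣+∣q─p∣ F⊆S) ⟨
      a * ∣ S ∣                 ≤⟨ ∣m-n∣≤o⇒n≤m+o (∣ S ∩ X j ∣ * f) (a * ∣ S ∣) (approx j) ⟩
      ∣ S ∩ X j ∣ * f + 3 * f   ≡⟨ cong (λ c → c * f + 3 * f) (p⊆q⇒∣q∩r∣≡∣p∩r∣+∣[q─p]∩r∣ (X j) F⊆S) ⟩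
      (x + y) * f + 3 * f       ≡⟨ regroup x y f ⟩
      x * f + (y + 3) * f       ≡⟨ cong (_+ (y + 3) * f) (exactlyFair⇒∣S∩Xj∣*f≡fj*∣S∣ {F} fairF j) ⟩
      a * ∣ F ∣ + (y + 3) * f   ∎)
      where
      open ≤-Reasoning
      a = fj f j
      x = ∣ F ∩ X j ∣
      y = ∣ (S ─ F) ∩ X j ∣
      regroup : ∀ x y f → (x + y) * f + 3 * f ≡ x * f + (y + 3) * f
      regroup = solve-∀

    fj≤∣[S─F]∩Xj∣ : 4 * f ≤ ∣ S ─ F ∣ → ∀ j → fj f j ≤ ∣ (S ─ F) ∩ X j ∣
    fj≤∣[S─F]∩Xj∣ 4f≤∣S─F∣ j = 4*m≤n+3⇒m≤n a y (*-cancelʳ-≤ (4 * a) (y + 3) f ⦃ >-nonZero 0<f ⦄ (begin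
      4 * a * f     ≡⟨ *-assoc 4 a f ⟩
      4 * (a * f)   ≡⟨ x∙yz≈y∙xz 4 a f ⟩
      a * (4 * f)   ≤⟨ *-monoʳ-≤ a 4f≤∣S─F∣ ⟩
      a * ∣ S ─ F ∣ ≤⟨ fj*∣S─F∣≤[∣[S─F]∩Xj∣+3]*f j ⟩
      (y + 3) * f   ∎))
      where
      open ≤-Reasoning
      a = fj f j
      y = ∣ (S ─ F) ∩ X j ∣

  ∣S─F∣<4f : ∀ {S F} → ApproxFair3 f S → MaximalFairSubset S F → ∣ S ─ F ∣ < 4 * f
  ∣S─F∣<4f {S} {F} approx (F⊆S , fairF , maximal) = ≰⇒> λ 4f≤∣S─F∣ →
    let T , T⊆S─F , fairletT =
          ∃⊆-with-fibre-sizes grp (S ─ F) (fj f) (fj≤∣[S─F]∩Xj∣ approx F⊆S fairF 4f≤∣S─F∣)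
        disjoint = p⊆q─r⇒Empty[r∩p] T⊆S─F
        F∪T⊆S : F ∪ T ⊆ S
        F∪T⊆S = [ F⊆S , p─q⊆p S F ∘ T⊆S─F ]′ ∘ x∈p∪q⁻ F T
        F∪T⊆F = maximal (F ∪ T) (p⊆p∪q T) F∪T⊆S
                  (∪-exactlyFair {F} {T} disjoint fairF (fairlet⇒exactlyFair {T} fairletT))
    in  <⇒≱ (m<m+n ∣ F ∣ 0<f) (begin
          ∣ F ∣ + f     ≡⟨ cong (∣ F ∣ +_) (fairlet⇒∣S∣≡f {T} fairletT) ⟨
          ∣ F ∣ + ∣ T ∣ ≡⟨ ∣p∪q∣≡∣p∣+∣q∣ disjoint ⟨
          ∣ F ∪ T ∣     ≤⟨ p⊆q⇒∣p∣≤∣q∣ F∪T⊆F ⟩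
          ∣ F ∣         ∎)
    where open ≤-Reasoning

lemma3 : {n ℓ k : ℕ} → .{{_ : NonZero n}}
    → (grp : Fin n → Fin ℓ) → (loc : Fin n → Fin k)
    → (f : ℕ) → Instance.IsFairletSize grp loc f
    → (∀ i → Instance.ApproxFair3 grp loc f (Instance.C grp loc i))
    → (F : Fin k → Subset n)
    → (∀ i → Instance.MaximalFairSubset grp loc (Instance.C grp loc i) (F i))
    → ∀ i → ∣ Instance.C grp loc i ─ F i ∣ < 4 * f
lemma3 grp loc f (0<f , n∣f*∣Xj∣ , _) approx F maximal i =
  Fairlets.∣S─F∣<4f grp loc f 0<f n∣f*∣Xj∣ (approx i) (maximal i)
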